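{- For every $\delta>0$ and $n\in\mathbb{N}$ there exists $N\in\mathbb{N}$ such that the following holds for every $N$-partitioned hypergraph $H$ and every choice of subsets $A_{ijk}\subseteq V_{ij}$, $i<j<k$, $i,j,k\in[N]$, with $|A_{ijk}|\ge\delta|V_{ij}|$. There exist an induced $n$-partitioned subhypergraph of $H$ with index set $I\subseteq[N]$ and vertices $\alpha_{ij}$, $i<j$, $i,j\in I$, such that $\alpha_{ij}\in A_{ijk}$ for all $k\in I$ with $k>j$.
   Context: An $N$-partitioned hypergraph $H$ is a $3$-uniform hypergraph whose vertex set is partitioned into nonempty finite sets $V_{ij}$, $1\le i<j\le N$, such that every edge has one vertex in each of $V_{ij},V_{ik},V_{jk}$ for some $1\le i<j<k\le N$. For $I\subseteq[N]$, the subhypergraph induced by $I$ is the $|I|$-partitioned hypergraph with parts $V_{ij}$, $i<j$, $i,j\in I$ (keeping original indices) and all edges of $H$ contained in the union of these parts; $I$ is its index set. -}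

module Defs where

open import Data.Nat using (ℕ; _≤_; _*_)
open import Data.Fin using (Fin; _<_)
open import Data.Fin.Subset using (Subset; _∈_; ∣_∣)
open import Data.Product using (Σ; _×_; ∃)
open import Relation.Binary.PropositionalEquality using (_≡_)

-- Indices [N] are represented by Fin N
-- (0-based). The part V_ij (for i < j) is Fin (size i j); `size i j` for i ≥ j
-- is irrelevant. Every edge has one vertex in each of V_ij, V_ik, V_jk for some
-- i < j < k; `Edge` is the edge relation on such triples.
record PartitionedHypergraph (N : ℕ) : Set₁ where
  field
    size     : Fin N → Fin N → ℕ
    nonempty : ∀ i j → i < j → 1 ≤ size i j
    Edge     : (i j k : Fin N) → i < j → j < k →
               Fin (size i j) → Fin (size i k) → Fin (size j k) → Set

open PartitionedHypergraph public

V : ∀ {N} → PartitionedHypergraph N → Fin N → Fin N → Set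
V H i j = Fin (size H i j)

-- The subsets A_ijk ⊆ V_ij (only used for i < j < k) with density ≥ p/q,
-- i.e. |A_ijk| ≥ (p/q)|V_ij|, written q·|A_ijk| ≥ p·|V_ij|.
Dense : ∀ {N} (H : PartitionedHypergraph N) (p q : ℕ) →
        ((i j k : Fin N) → Subset (size H i j)) → Set
Dense {N} H p q A = ∀ (i j k : Fin N) → i < j → j < k →
  p * size H i j ≤ q * ∣ A i j k ∣

HasGoodIndexSet : ∀ {N} (H : PartitionedHypergraph N) (n : ℕ) →
                  ((i j k : Fin N) → Subset (size H i j)) → Set
HasGoodIndexSet {N} H n A =
  Σ (Subset N) λ I →
    ∣ I ∣ ≡ n ×
    Σ ((i j : Fin N) → i ∈ I → j ∈ I → i < j → V H i j) λ α →
      ∀ (i j k : Fin N) (i∈I : i ∈ I) (j∈I : j ∈ I) → k ∈ I →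
        (i<j : i < j) → j < k → α i j i∈I j∈I i<j ∈ A i j k

{-# OPTIONS --safe #-}
-- The index set is built greedily from left to right. Alongside the chosen indices and
-- the labels α_ij of chosen pairs we keep a sorted list of candidate indices above all
-- chosen ones, such that every label α_ij lies in A_ijk for every chosen or candidate
-- k > j. The smallest candidate c is chosen next, and its labels α_ac are fixed one
-- chosen a at a time: since each A_ack has density at least p/q in V_ac, averaging over
-- V_ac yields a vertex lying in A_ack for at least a p/q ≥ 1/q fraction of the remaining
-- candidates, and only those are kept. A new index costs at most n such factors q, so
-- threshold (q^n) r candidates suffice for r further choices.
module Submission where

open import Defs
open import Data.Bool.Base using (true; false; if_then_else_)
open import Data.Empty using (⊥-elim)
open import Data.Fin.Base using (Fin; zero; suc; _<_; fromℕ<)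
open import Data.Fin.Properties using (_≟_; <⇒≢; <-irrefl; <-asym)
open import Data.Fin.Subset using (Subset; ∣_∣; ⁅_⁆; _∪_; ⋃; inside; outside)
  renaming (_∈_ to _∈ₛ_; _∉_ to _∉ₛ_)
open import Data.Fin.Subset.Properties
  using (_∈?_; ∉⊥; ∪-identityˡ; x∈p∪q⁻; x∈⁅y⁆⇒x≡y; ∣⊥∣≡0)
open import Data.List.Base using (List; []; _∷_; _++_; length; map; filter; allFin)
open import Data.List.Properties using (length-tabulate)
open import Data.List.Membership.Propositional using (_∈_)
open import Data.List.Membership.Propositional.Properties
  using (∈-filter⁻; ∈-++⁺ˡ; ∈-++⁺ʳ; ∈-++⁻)
open import Data.List.Relation.Binary.Subset.Propositional using (_⊆_)
open import Data.List.Relation.Unary.All as All using (All; []; _∷_)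
import Data.List.Relation.Unary.All.Properties as All
open import Data.List.Relation.Unary.AllPairs using (AllPairs; []; _∷_)
import Data.List.Relation.Unary.AllPairs.Properties as AllPairs
open import Data.List.Relation.Unary.Any using (here; there)
open import Data.List.Relation.Unary.Unique.Propositional using (Unique)
open import Data.Nat.Base using (ℕ; zero; suc; _+_; _*_; _^_; _≤_; z≤n; s≤s; NonZero; >-nonZero)
open import Data.Nat.Properties
  using (≤-refl; ≤-trans; <⇒≤; ≰⇒>; _≤?_; +-mono-≤; +-monoʳ-≤; *-monoʳ-≤; *-monoˡ-≤; ^-monoʳ-≤;
         *-identityˡ; +-identityʳ; *-assoc; +-suc; *-distribˡ-+; *-cancelˡ-≤; m≤n*m; m+n≤o⇒m≤o; ≤-reflexive;
         module ≤-Reasoning; +-0-commutativeMonoid; *-commutativeSemigroup)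
open import Data.Nat.ListAction as List using ()
open import Algebra.Properties.CommutativeMonoid.Sum +-0-commutativeMonoid
  using (sum; sum-syntax; ∑-distrib-+; sum-cong-≗; sum-replicate-zero)
open import Algebra.Properties.CommutativeSemigroup *-commutativeSemigroup
  using (x∙yz≈z∙yx; x∙yz≈y∙xz)
open import Data.Product using (Σ; ∃-syntax; _,_; proj₁; proj₂)
open import Data.Sum using (inj₁; inj₂)
import Data.Vec.Base as Vec
open import Data.Vec.Base using ([]; _∷_)
open import Data.Vec.Functional using (Vector)
open import Function.Base using (_∘_; id)
open import Relation.Nullary using (Dec; does; yes; no)
open import Relation.Unary using (Pred; Decidable)
open import Relation.Binary.PropositionalEquality

indicator : ∀ {P : Set} → Dec P → ℕ
indicator d = if does d then 1 else 0

sum≤n*largest : ∀ {m} .{{_ : NonZero m}} (f : Vector ℕ m) → ∃[ y ] sum f ≤ m * f y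
sum≤n*largest {1}           f = zero , ≤-refl
sum≤n*largest {suc (suc m)} f with sum≤n*largest (f ∘ suc)
... | y , sum≤ with f zero ≤? f (suc y)
...   | yes f₀≤ = suc y , +-mono-≤ f₀≤ sum≤
...   | no  f₀≰ = zero , +-monoʳ-≤ (f zero) (≤-trans sum≤ (*-monoʳ-≤ (suc m) (<⇒≤ (≰⇒> f₀≰))))

∣p∣≡∑indicator : ∀ {s} (p : Subset s) → ∣ p ∣ ≡ ∑[ y < s ] indicator (y ∈? p)
∣p∣≡∑indicator []            = refl
∣p∣≡∑indicator (inside ∷ p)  = cong suc (∣p∣≡∑indicator p)
∣p∣≡∑indicator (outside ∷ p) = ∣p∣≡∑indicator p

length-filter-∷ : ∀ {X : Set} {P : Pred X _} (P? : Decidable P) x xs →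
                  length (filter P? (x ∷ xs)) ≡ indicator (P? x) + length (filter P? xs)
length-filter-∷ P? x xs with does (P? x)
... | true  = refl
... | false = refl

length*≤*sum : ∀ {X : Set} {c} q (f : X → ℕ) {L} → All (λ x → c ≤ q * f x) L →
               length L * c ≤ q * List.sum (map f L)
length*≤*sum q f []                    = z≤n
length*≤*sum {c = c} q f {x ∷ L} (c≤ ∷ L≤) =
  subst (c + length L * c ≤_) (sym (*-distribˡ-+ q (f x) (List.sum (map f L))))
        (+-mono-≤ c≤ (length*≤*sum q f L≤))

module DoubleCounting {X : Set} {s : ℕ} (B : X → Subset s) where

  hits : Fin s → List X → List X
  hits y = filter (λ x → y ∈? B x)

  hits⊆ : ∀ y L → hits y L ⊆ L
  hits⊆ y L x∈ = proj₁ (∈-filter⁻ (λ x → y ∈? B x) {xs = L} x∈)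

  ∈-hits⁻ : ∀ y L {x} → x ∈ hits y L → y ∈ₛ B x
  ∈-hits⁻ y L x∈ = proj₂ (∈-filter⁻ (λ x → y ∈? B x) {xs = L} x∈)

  ∑-length-hits : ∀ L → ∑[ y < s ] length (hits y L) ≡ List.sum (map (∣_∣ ∘ B) L)
  ∑-length-hits []      = sum-replicate-zero s
  ∑-length-hits (x ∷ L) = begin
    ∑[ y < s ] length (hits y (x ∷ L))
      ≡⟨ sum-cong-≗ (λ y → length-filter-∷ (λ x → y ∈? B x) x L) ⟩
    ∑[ y < s ] (indicator (y ∈? B x) + length (hits y L))
      ≡⟨ ∑-distrib-+ (λ y → indicator (y ∈? B x)) (λ y → length (hits y L)) ⟩
    ∑[ y < s ] indicator (y ∈? B x) + ∑[ y < s ] length (hits y L)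
      ≡⟨ cong₂ _+_ (sym (∣p∣≡∑indicator (B x))) (∑-length-hits L) ⟩
    ∣ B x ∣ + List.sum (map (∣_∣ ∘ B) L)
      ∎
    where open ≡-Reasoning

  pigeonhole : ∀ {p q} .{{_ : NonZero s}} L → All (λ x → p * s ≤ q * ∣ B x ∣) L →
               ∃[ y ] p * length L ≤ q * length (hits y L)
  pigeonhole {p} {q} L dense with sum≤n*largest (λ y → length (hits y L))
  ... | y , largest = y , *-cancelˡ-≤ s (begin
    s * (p * length L)                ≡⟨ x∙yz≈z∙yx s p (length L) ⟩
    length L * (p * s)                ≤⟨ length*≤*sum q (∣_∣ ∘ B) dense ⟩
    q * List.sum (map (∣_∣ ∘ B) L)    ≡⟨ cong (q *_) (sym (∑-length-hits L)) ⟩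
    q * ∑[ y < s ] length (hits y L)  ≤⟨ *-monoʳ-≤ q largest ⟩
    q * (s * length (hits y L))       ≡⟨ x∙yz≈y∙xz q s _ ⟩
    s * (q * length (hits y L))       ∎)
    where open ≤-Reasoning

fromList : ∀ {m} → List (Fin m) → Subset m
fromList = ⋃ ∘ map ⁅_⁆

∈-fromList⁻ : ∀ {m} (C : List (Fin m)) {i} → i ∈ₛ fromList C → i ∈ C
∈-fromList⁻ []      i∈ = ⊥-elim (∉⊥ i∈)
∈-fromList⁻ (c ∷ C) i∈ with x∈p∪q⁻ ⁅ c ⁆ (fromList C) i∈
... | inj₁ i∈⁅c⁆ = here (x∈⁅y⁆⇒x≡y c i∈⁅c⁆)
... | inj₂ i∈C   = there (∈-fromList⁻ C i∈C)

∣⁅x⁆∪p∣≡1+∣p∣ : ∀ {m} {x : Fin m} (p : Subset m) → x ∉ₛ p → ∣ ⁅ x ⁆ ∪ p ∣ ≡ suc ∣ p ∣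
∣⁅x⁆∪p∣≡1+∣p∣ {x = zero}  (inside  ∷ p) x∉p = ⊥-elim (x∉p Vec.here)
∣⁅x⁆∪p∣≡1+∣p∣ {x = zero}  (outside ∷ p) _   = cong (suc ∘ ∣_∣) (∪-identityˡ p)
∣⁅x⁆∪p∣≡1+∣p∣ {x = suc x} (inside  ∷ p) x∉p = cong suc (∣⁅x⁆∪p∣≡1+∣p∣ p (x∉p ∘ Vec.there))
∣⁅x⁆∪p∣≡1+∣p∣ {x = suc x} (outside ∷ p) x∉p = ∣⁅x⁆∪p∣≡1+∣p∣ p (x∉p ∘ Vec.there)

∣fromList∣ : ∀ {m} {C : List (Fin m)} → Unique C → ∣ fromList C ∣ ≡ length C
∣fromList∣ {m} {[]}    []             = ∣⊥∣≡0 m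
∣fromList∣ {C = c ∷ C} (c∉C ∷ C-unique) =
  trans (∣⁅x⁆∪p∣≡1+∣p∣ (fromList C) (λ c∈ → All.lookup c∉C (∈-fromList⁻ C c∈) refl))
        (cong suc (∣fromList∣ C-unique))

update : ∀ {m} {P : Fin m → Set} → ((x : Fin m) → P x) → (a : Fin m) → P a → (x : Fin m) → P x
update f a v x with x ≟ a
... | yes refl = v
... | no  _    = f x

update-≡ : ∀ {m} {P : Fin m → Set} (f : (x : Fin m) → P x) a v → update f a v a ≡ v
update-≡ f a v with a ≟ a
... | yes refl = refl
... | no  a≢a  = ⊥-elim (a≢a refl)

update-≢ : ∀ {m} {P : Fin m → Set} (f : (x : Fin m) → P x) a v {x} → x ≢ a → update f a v x ≡ f x
update-≢ f a v {x} x≢a with x ≟ a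
... | yes x≡a = ⊥-elim (x≢a x≡a)
... | no  _   = refl

threshold : ℕ → ℕ → ℕ
threshold Q zero    = 0
threshold Q (suc r) = suc (Q * threshold Q r)

module Greedy {N} (H : PartitionedHypergraph N) (A : (i j k : Fin N) → Subset (size H i j))
              {p q} .{{_ : NonZero p}} .{{_ : NonZero q}} (dense : Dense H p q A) (n : ℕ) where

  Column : Fin N → Set
  Column j = (i : Fin N) → i < j → V H i j

  Labelling : Set
  Labelling = (j : Fin N) → Column j

  someColumn : (j : Fin N) → Column j
  someColumn j i i<j = fromℕ< (nonempty H i j i<j)

  record Thinning (c : Fin N) (D L : List (Fin N)) (x : ℕ) : Set where
    field
      column      : Column c
      kept        : List (Fin N)
      kept⊆L      : kept ⊆ L
      kept-sorted : AllPairs _<_ kept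
      column-fits : ∀ {a k} → a ∈ D → k ∈ kept → (a<c : a < c) → column a a<c ∈ₛ A a c k
      kept-large  : x ≤ length kept

  thin : ∀ c {D} → All (_< c) D → ∀ {L} → AllPairs _<_ L → All (c <_) L →
         ∀ x → q ^ length D * x ≤ length L → Thinning c D L x
  thin c [] {L} L-sorted _ x L-large = record
    { column      = someColumn c
    ; kept        = L
    ; kept⊆L      = id
    ; kept-sorted = L-sorted
    ; column-fits = λ ()
    ; kept-large  = subst (_≤ length L) (*-identityˡ x) L-large
    }
  thin c {a ∷ D} (a<c ∷ D<c) {L} L-sorted c<L x L-large = record
    { column      = column′
    ; kept        = kept
    ; kept⊆L      = hits⊆ y L ∘ kept⊆L
    ; kept-sorted = kept-sorted
    ; column-fits = fits
    ; kept-large  = kept-large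
    }
    where
    open DoubleCounting (A a c)

    pick : ∃[ y ] p * length L ≤ q * length (hits y L)
    pick = pigeonhole {p} {q} {{>-nonZero (nonempty H a c a<c)}} L (All.map (dense a c _ a<c) c<L)

    y : V H a c
    y = proj₁ pick

    hits-large : q ^ length D * x ≤ length (hits y L)
    hits-large = *-cancelˡ-≤ q (begin
      q * (q ^ length D * x)  ≡⟨ sym (*-assoc q _ x) ⟩
      q ^ length (a ∷ D) * x  ≤⟨ L-large ⟩
      length L                ≤⟨ m≤n*m (length L) p ⟩
      p * length L            ≤⟨ proj₂ pick ⟩
      q * length (hits y L)   ∎)
      where open ≤-Reasoning

    open Thinning (thin c D<c (AllPairs.filter⁺ _ L-sorted) (All.filter⁺ _ c<L) x hits-large)

    column′ : Column c
    column′ = update column a (λ _ → y)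

    y-fits : ∀ {k} → k ∈ kept → (a<c : a < c) → column′ a a<c ∈ₛ A a c k
    y-fits k∈ a<c rewrite update-≡ column a (λ _ → y) = ∈-hits⁻ y L (kept⊆L k∈)

    fits : ∀ {a′ k} → a′ ∈ a ∷ D → k ∈ kept → (a′<c : a′ < c) → column′ a′ a′<c ∈ₛ A a′ c k
    fits (here refl)  = y-fits
    fits (there a′∈D) = fits-row (_ ≟ a) a′∈D
      where
      fits-row : ∀ {a′ k} → Dec (a′ ≡ a) → a′ ∈ D → k ∈ kept → (a′<c : a′ < c) →
                 column′ a′ a′<c ∈ₛ A a′ c k
      fits-row (yes refl) _ = y-fits
      fits-row (no a′≢a) a′∈D k∈ a′<c rewrite update-≢ column a (λ _ → y) a′≢a =
        column-fits a′∈D k∈ a′<c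

  record Partial (r : ℕ) : Set where
    constructor partial
    field
      chosen            : List (Fin N)
      candidates        : List (Fin N)
      labels            : Labelling
      #chosen           : length chosen + r ≡ n
      chosen-unique     : Unique chosen
      candidates-sorted : AllPairs _<_ candidates
      chosen<candidates : All (λ a → All (a <_) candidates) chosen
      labels-fit        : ∀ {i j k} → i ∈ chosen → j ∈ chosen → k ∈ chosen ++ candidates →
                          (i<j : i < j) → j < k → labels j i i<j ∈ₛ A i j k
      enough            : threshold (q ^ n) r ≤ length candidates

  step : ∀ {r} → Partial (suc r) → Partial r
  step {r} (partial C (c ∷ K) β #C C-unique (c<K ∷ K-sorted) C<cK fit (s≤s enough)) =
    partial (c ∷ C) kept (update β c column) #C′ (All.map c≢ C<c ∷ C-unique) kept-sorted
            (All.anti-mono kept⊆L c<K ∷ All.map (All.anti-mono (there ∘ kept⊆L)) C<cK) fit′ kept-large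
    where
    C<c : All (_< c) C
    C<c = All.map All.head C<cK

    c≢ : ∀ {a} → a < c → c ≢ a
    c≢ a<c = ≢-sym (<⇒≢ a<c)

    #C′ : length (c ∷ C) + r ≡ n
    #C′ = trans (sym (+-suc (length C) r)) #C

    K-large : q ^ length C * threshold (q ^ n) r ≤ length K
    K-large = ≤-trans (*-monoˡ-≤ _ (^-monoʳ-≤ q (m+n≤o⇒m≤o (length C) (≤-reflexive #C)))) enough

    open Thinning (thin c C<c K-sorted c<K (threshold (q ^ n) r) K-large)

    later⇒kept : ∀ {k} → k ∈ (c ∷ C) ++ kept → c < k → k ∈ kept
    later⇒kept (here refl) c<c = ⊥-elim (<-irrefl refl c<c)
    later⇒kept (there k∈) c<k with ∈-++⁻ C k∈
    ... | inj₁ k∈C    = ⊥-elim (<-asym c<k (All.lookup C<c k∈C))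
    ... | inj₂ k∈kept = k∈kept

    seen-before : ∀ {k} → k ∈ (c ∷ C) ++ kept → k ∈ C ++ (c ∷ K)
    seen-before (here refl) = ∈-++⁺ʳ C (here refl)
    seen-before (there k∈) with ∈-++⁻ C k∈
    ... | inj₁ k∈C    = ∈-++⁺ˡ k∈C
    ... | inj₂ k∈kept = ∈-++⁺ʳ C (there (kept⊆L k∈kept))

    fit′ : ∀ {i j k} → i ∈ c ∷ C → j ∈ c ∷ C → k ∈ (c ∷ C) ++ kept →
           (i<j : i < j) → j < k → update β c column j i i<j ∈ₛ A i j k
    fit′ (here refl) (here refl)  _ c<c _ = ⊥-elim (<-irrefl refl c<c)
    fit′ (here refl) (there j∈C)  _ c<j _ = ⊥-elim (<-asym c<j (All.lookup C<c j∈C))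
    fit′ (there i∈C) (here refl) k∈ i<c c<k rewrite update-≡ β c column =
      column-fits i∈C (later⇒kept k∈ c<k) i<c
    fit′ (there i∈C) (there j∈C) k∈ i<j j<k rewrite update-≢ β c column (<⇒≢ (All.lookup C<c j∈C)) =
      fit i∈C j∈C (seen-before k∈) i<j j<k

  run : ∀ r → Partial r → Partial 0
  run zero    = id
  run (suc r) = run r ∘ step

  initial : threshold (q ^ n) n ≤ N → Partial n
  initial N-large = partial [] (allFin N) someColumn refl [] (AllPairs.tabulate⁺-< id) []
                            (λ ()) (subst (_ ≤_) (sym (length-tabulate id)) N-large)

  finish : Partial 0 → HasGoodIndexSet H n A
  finish (partial C _ β #C C-unique _ _ fit _) =
    fromList C , trans (∣fromList∣ C-unique) (trans (sym (+-identityʳ _)) #C) ,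
    (λ i j _ _ → β j i) ,
    λ i j k i∈ j∈ k∈ → fit (∈-fromList⁻ C i∈) (∈-fromList⁻ C j∈) (∈-++⁺ˡ (∈-fromList⁻ C k∈))

  greedy : threshold (q ^ n) n ≤ N → HasGoodIndexSet H n A
  greedy = finish ∘ run n ∘ initial

lemma10 : (p q : ℕ) → 1 ≤ p → 1 ≤ q → (n : ℕ) →
    Σ ℕ λ N → (H : PartitionedHypergraph N) →
      (A : (i j k : Fin N) → Subset (size H i j)) →
      Dense H p q A → HasGoodIndexSet H n A
lemma10 p q 1≤p 1≤q n = threshold (q ^ n) n , λ H A dense →
  Greedy.greedy H A {{>-nonZero 1≤p}} {{>-nonZero 1≤q}} dense n ≤-refl
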